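{- If there exists a DTS$(v)$ having a $v$-good sequencing, then there exists a DTS$(2v+4)$ having a $(2v+4)$-good sequencing.
   Context: A transitive triple is an ordered triple $(x,y,z)$ of distinct elements; it contains the directed edges $(x,y)$, $(x,z)$, $(y,z)$. A directed triple system of order $v$, DTS$(v)$, is a pair $(X,\mathcal{B})$ where $X$ is a set of $v$ points and $\mathcal{B}$ is a set of transitive triples of elements of $X$ such that every ordered pair $(a,b)$ of distinct points of $X$ occurs as a directed edge in exactly one triple of $\mathcal{B}$. A $v$-good sequencing of a DTS$(v)$ $(X,\mathcal{B})$ is a permutation $[x_1\, x_2\, \cdots\, x_v]$ of $X$ such that for no triple $(x,y,z)\in\mathcal{B}$ do we have $x=x_i$, $y=x_j$, $z=x_k$ with $i<j<k$. -}

module Defs where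

open import Data.Nat using (ℕ; _+_; _*_)
open import Data.Fin using (Fin; _<_)
open import Data.Product using (Σ; ∃; _×_; _,_)
open import Data.Sum using (_⊎_)
open import Data.List using (List)
open import Data.List.Membership.Propositional using (_∈_)
open import Data.List.Relation.Unary.Unique.Propositional using (Unique)
open import Function.Bundles using (_↔_; Inverse)
open import Relation.Binary.PropositionalEquality using (_≡_; _≢_)
open import Relation.Nullary using (¬_)

record Triple (v : ℕ) : Set where
  constructor ⟨_,_,_⟩
  field
    fst snd thd : Fin v

open Triple public

Distinct : ∀ {v} → Triple v → Set
Distinct t = fst t ≢ snd t × fst t ≢ thd t × snd t ≢ thd t

HasEdge : ∀ {v} → Triple v → Fin v → Fin v → Set
HasEdge t a b =
  (a ≡ fst t × b ≡ snd t) ⊎ (a ≡ fst t × b ≡ thd t) ⊎ (a ≡ snd t × b ≡ thd t)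

record IsDTS (v : ℕ) (B : List (Triple v)) : Set where
  field
    unique   : Unique B
    distinct : ∀ {t} → t ∈ B → Distinct t
    covered  : ∀ (a b : Fin v) → a ≢ b → ∃ λ t → t ∈ B × HasEdge t a b
    once     : ∀ (a b : Fin v) {t u} → t ∈ B → u ∈ B →
               HasEdge t a b → HasEdge u a b → t ≡ u

IsGoodSequencing : ∀ {v} → List (Triple v) → (Fin v ↔ Fin v) → Set
IsGoodSequencing {v} B σ =
  ∀ {t} → t ∈ B → ¬ (Σ (Fin v) λ i → Σ (Fin v) λ j → Σ (Fin v) λ k →
      i < j × j < k × Inverse.to σ i ≡ fst t × Inverse.to σ j ≡ snd t × Inverse.to σ k ≡ thd t)

HasGoodDTS : ℕ → Set
HasGoodDTS v = Σ (List (Triple v)) λ B → IsDTS v B × Σ (Fin v ↔ Fin v) λ σ → IsGoodSequencing B σ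

module Submission where

-- Take the points X ∪ ℤ/n with n = v + 4, so 2v + 4 points, X numbered 0, …, v - 1.  Keep
-- the old triples; add the translates of the base block (0, v + 3, 2v + 5) of ℤ/n, whose
-- edges realise the differences v + 3, v + 2 and v + 1 = 2v + 5 - n; and add (x, a, x + a + 1)
-- for x ∈ ℤ/n and a ∈ X, which covers the differences 1, …, v and every pair between X and
-- ℤ/n.  Sequence X by the old sequencing, followed by 0, …, n - 1.  An old triple stays
-- badly ordered, (x, a, x + a + 1) has its first point after its second, and an ascending
-- translate (x, x + v + 3, x + 2v + 5) would need x + 2v + 5 < n = v + 4.

open import Defs
open import Data.Nat using (ℕ; zero; suc; _+_; _*_; _∸_; _≤_; _<_; z<s; s<s; _≟_; _<?_; _≤?_)
open import Data.Nat.Properties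
open import Data.Nat.Tactic.RingSolver using (solve-∀)
open import Algebra.Properties.CommutativeSemigroup +-commutativeSemigroup using (xy∙z≈xz∙y)
open import Data.Fin as Fin using (Fin; toℕ; fromℕ<; _↑ˡ_; _↑ʳ_; splitAt)
open import Data.Fin.Properties
  using ( toℕ<n; toℕ-fromℕ<; toℕ-injective; toℕ-↑ˡ; toℕ-↑ʳ; ↑ˡ-injective
        ; splitAt⁻¹-↑ˡ; splitAt⁻¹-↑ʳ; splitAt-<; +↔⊎)
open import Data.Product using (Σ; ∃; ∃₂; _×_; _,_; proj₁; proj₂)
open import Data.Sum using (_⊎_; inj₁; inj₂)
open import Data.Empty using (⊥; ⊥-elim)
open import Data.List using (List; map; filter; cartesianProductWith; cartesianProduct; allFin)
open import Data.List.Membership.Propositional using (_∈_)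
open import Data.List.Membership.Propositional.Properties
  using ( ∈-map⁺; ∈-map⁻; ∈-filter⁺; ∈-filter⁻
        ; ∈-cartesianProductWith⁺; ∈-cartesianProduct⁺; ∈-allFin)
open import Data.List.Relation.Unary.Unique.Propositional using (Unique)
import Data.List.Relation.Unary.Unique.Propositional.Properties as Unique
open import Function using (_∘_)
open import Function.Bundles using (_↔_; Inverse)
open import Function.Definitions using (Injective)
open import Function.Construct.Composition using (_↔-∘_)
open import Function.Construct.Identity using (↔-id)
open import Function.Construct.Symmetry using (↔-sym)
open import Data.Sum.Function.Propositional using (_⊎-↔_)
open import Relation.Nullary using (¬_; Dec; yes; no; contradiction)
open import Relation.Nullary.Decidable using (map′; _×-dec_; _⊎-dec_)
open import Relation.Unary using (Decidable)
open import Relation.Binary.Definitions using (DecidableEquality)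
open import Relation.Binary.PropositionalEquality

open Inverse using (to)

module CyclicShift (o n : ℕ) where

  -- ℤ/n is represented by the top n points of Fin (o + n), the residue r being the point o + r;
  -- p ⟶[ d ] q says that q = p + d in ℤ/n.
  High : Fin (o + n) → Set
  High p = o ≤ toℕ p

  high? : Decidable High
  high? p = o ≤? toℕ p

  data _⟶[_]_ (p : Fin (o + n)) (d : ℕ) (q : Fin (o + n)) : Set where
    direct  : toℕ p + d ≡ toℕ q     → p ⟶[ d ] q
    wrapped : toℕ p + d ≡ toℕ q + n → p ⟶[ d ] q

  _⟶?[_]_ : ∀ p d q → Dec (p ⟶[ d ] q)
  p ⟶?[ d ] q with toℕ p + d ≟ toℕ q | toℕ p + d ≟ toℕ q + n
  ... | yes e | _      = yes (direct e)
  ... | no _  | yes e  = yes (wrapped e)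
  ... | no ¬e | no ¬e′ = no λ { (direct e) → ¬e e ; (wrapped e) → ¬e′ e }

  private
    high-span : ∀ {p q : Fin (o + n)} → High q → toℕ p < toℕ q + n
    high-span {p} o≤q = <-≤-trans (toℕ<n p) (+-monoˡ-≤ n o≤q)

    high-narrow : ∀ {p q : Fin (o + n)} → High q → toℕ p ≢ toℕ q + n
    high-narrow hq e = <-irrefl e (high-span hq)

    source-not-both : ∀ {d} {p p′ q : Fin (o + n)} → High p →
                      toℕ p + d ≡ toℕ q → toℕ p′ + d ≢ toℕ q + n
    source-not-both {d} {p} {p′} {q} hp e e′ = high-narrow hp (+-cancelʳ-≡ d (toℕ p′) (toℕ p + n) (begin
      toℕ p′ + d     ≡⟨ e′ ⟩
      toℕ q + n      ≡⟨ cong (_+ n) e ⟨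
      toℕ p + d + n  ≡⟨ xy∙z≈xz∙y (toℕ p) d n ⟩
      toℕ p + n + d  ∎))
      where open ≡-Reasoning

    distance-not-both : ∀ {d d′} {p q : Fin (o + n)} → d′ < n →
                        toℕ p + d ≡ toℕ q → toℕ p + d′ ≢ toℕ q + n
    distance-not-both {d} {d′} {p} {q} d′<n e e′ =
      <⇒≱ d′<n (subst (n ≤_) (+-cancelˡ-≡ (toℕ p) (d + n) d′ x+[d+n]≡x+d′) (m≤n+m n d))
      where
      open ≡-Reasoning
      x+[d+n]≡x+d′ : toℕ p + (d + n) ≡ toℕ p + d′
      x+[d+n]≡x+d′ = begin
        toℕ p + (d + n) ≡⟨ +-assoc (toℕ p) d n ⟨
        toℕ p + d + n   ≡⟨ cong (_+ n) e ⟩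
        toℕ q + n       ≡⟨ e′ ⟨
        toℕ p + d′      ∎

  ⟶-target-unique : ∀ {d p q q′} → High q → High q′ → p ⟶[ d ] q → p ⟶[ d ] q′ → q ≡ q′
  ⟶-target-unique _  _   (direct e)  (direct e′)  = toℕ-injective (trans (sym e) e′)
  ⟶-target-unique _  hq′ (direct e)  (wrapped e′) = ⊥-elim (high-narrow hq′ (trans (sym e) e′))
  ⟶-target-unique hq _   (wrapped e) (direct e′)  = ⊥-elim (high-narrow hq (trans (sym e′) e))
  ⟶-target-unique {q = q} {q′} _ _ (wrapped e) (wrapped e′) =
    toℕ-injective (+-cancelʳ-≡ n (toℕ q) (toℕ q′) (trans (sym e) e′))

  ⟶-source-unique : ∀ {d p p′ q} → High p → High p′ → p ⟶[ d ] q → p′ ⟶[ d ] q → p ≡ p′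
  ⟶-source-unique {d} {p} {p′} _ _ (direct e) (direct e′) =
    toℕ-injective (+-cancelʳ-≡ d (toℕ p) (toℕ p′) (trans e (sym e′)))
  ⟶-source-unique hp _   (direct e)  (wrapped e′) = ⊥-elim (source-not-both hp e e′)
  ⟶-source-unique _  hp′ (wrapped e) (direct e′)  = ⊥-elim (source-not-both hp′ e′ e)
  ⟶-source-unique {d} {p} {p′} _ _ (wrapped e) (wrapped e′) =
    toℕ-injective (+-cancelʳ-≡ d (toℕ p) (toℕ p′) (trans e (sym e′)))

  ⟶-distance-unique : ∀ {d d′ p q} → d < n → d′ < n → p ⟶[ d ] q → p ⟶[ d′ ] q → d ≡ d′
  ⟶-distance-unique {d} {d′} {p} _ _ (direct e) (direct e′) =
    +-cancelˡ-≡ (toℕ p) d d′ (trans e (sym e′))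
  ⟶-distance-unique _   d′<n (direct e)  (wrapped e′) = ⊥-elim (distance-not-both d′<n e e′)
  ⟶-distance-unique d<n _    (wrapped e) (direct e′)  = ⊥-elim (distance-not-both d<n e′ e)
  ⟶-distance-unique {d} {d′} {p} _ _ (wrapped e) (wrapped e′) =
    +-cancelˡ-≡ (toℕ p) d d′ (trans e (sym e′))

  ⟶-trans : ∀ {d e f p q r} → d + e ≡ f + n → High p → p ⟶[ d ] q → q ⟶[ e ] r → p ⟶[ f ] r
  ⟶-trans {d} {e} {f} {p} {q} {r} d+e≡f+n o≤p = go
    where
    open ≡-Reasoning
    x y z : ℕ
    x = toℕ p
    y = toℕ q
    z = toℕ r
    x+f+n≡x+d+e : x + f + n ≡ x + d + e
    x+f+n≡x+d+e = begin
      x + f + n   ≡⟨ +-assoc x f n ⟩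
      x + (f + n) ≡⟨ cong (x +_) d+e≡f+n ⟨
      x + (d + e) ≡⟨ +-assoc x d e ⟨
      x + d + e   ∎
    go : p ⟶[ d ] q → q ⟶[ e ] r → p ⟶[ f ] r
    go (direct a) (direct b) = ⊥-elim (<⇒≱ (toℕ<n r) (subst (o + n ≤_) x+f+n≡z o+n≤x+f+n))
      where
      x+f+n≡z : x + f + n ≡ z
      x+f+n≡z = trans x+f+n≡x+d+e (trans (cong (_+ e) a) b)
      o+n≤x+f+n : o + n ≤ x + f + n
      o+n≤x+f+n = +-monoˡ-≤ n (≤-trans o≤p (m≤m+n x f))
    go (direct a) (wrapped b) = direct (+-cancelʳ-≡ n (x + f) z (begin
      x + f + n ≡⟨ x+f+n≡x+d+e ⟩
      x + d + e ≡⟨ cong (_+ e) a ⟩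
      y + e     ≡⟨ b ⟩
      z + n     ∎))
    go (wrapped a) (direct b) = direct (+-cancelʳ-≡ n (x + f) z (begin
      x + f + n ≡⟨ x+f+n≡x+d+e ⟩
      x + d + e ≡⟨ cong (_+ e) a ⟩
      y + n + e ≡⟨ xy∙z≈xz∙y y n e ⟩
      y + e + n ≡⟨ cong (_+ n) b ⟩
      z + n     ∎))
    go (wrapped a) (wrapped b) = wrapped (+-cancelʳ-≡ n (x + f) (z + n) (begin
      x + f + n ≡⟨ x+f+n≡x+d+e ⟩
      x + d + e ≡⟨ cong (_+ e) a ⟩
      y + n + e ≡⟨ xy∙z≈xz∙y y n e ⟩
      y + e + n ≡⟨ cong (_+ n) b ⟩
      z + n + n ∎))

  ⟶-ascending : ∀ {d p q} → d < n → toℕ p < toℕ q → p ⟶[ d ] q → toℕ p + d ≡ toℕ q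
  ⟶-ascending _ _ (direct e) = e
  ⟶-ascending {d} {p} {q} d<n p<q (wrapped e) =
    ⊥-elim (<-asym p<q (+-cancelʳ-< n (toℕ q) (toℕ p) (subst (_< toℕ p + n) e (+-monoʳ-< (toℕ p) d<n))))

  ⟶-positive⇒≢ : ∀ {d p q} → 0 < d → d < n → p ⟶[ d ] q → p ≢ q
  ⟶-positive⇒≢ {p = p} 0<d d<n s refl
    with ⟶-distance-unique d<n (<-trans 0<d d<n) s (direct (+-identityʳ (toℕ p)))
  ... | refl = <-irrefl refl 0<d

  private
    ∸-<ˡ : ∀ {a b c} → a < b + c → c ≤ a → a ∸ c < b
    ∸-<ˡ {a} {b} {c} a<b+c c≤a = subst (a ∸ c <_) (m+n∸n≡m b c) (∸-monoˡ-< a<b+c c≤a)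

    point : ∀ {y} → o ≤ y → y < o + n → ∃ λ q → High q × toℕ q ≡ y
    point {y} o≤y y<o+n = fromℕ< y<o+n , subst (o ≤_) (sym eq) o≤y , eq
      where
      eq : toℕ (fromℕ< y<o+n) ≡ y
      eq = toℕ-fromℕ< y<o+n

  ⟶-target-exists : ∀ {p d} → High p → d < n → ∃ λ q → High q × p ⟶[ d ] q
  ⟶-target-exists {p} {d} o≤p d<n with toℕ p + d <? o + n
  ... | yes p+d<o+n =
    let q , hq , e = point (≤-trans o≤p (m≤m+n (toℕ p) d)) p+d<o+n in q , hq , direct (sym e)
  ... | no p+d≮o+n =
    let q , hq , e = point (m+n≤o⇒m≤o∸n o o+n≤p+d) (∸-<ˡ (+-mono-< (toℕ<n p) d<n) n≤p+d)
    in  q , hq , wrapped (trans (sym (m∸n+n≡m n≤p+d)) (cong (_+ n) (sym e)))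
    where
    o+n≤p+d : o + n ≤ toℕ p + d
    o+n≤p+d = ≮⇒≥ p+d≮o+n
    n≤p+d : n ≤ toℕ p + d
    n≤p+d = m+n≤o⇒n≤o o o+n≤p+d

  ⟶-source-exists : ∀ {q d} → High q → d < n → ∃ λ p → High p × p ⟶[ d ] q
  ⟶-source-exists {q} {d} o≤q d<n with o + d ≤? toℕ q
  ... | yes o+d≤q =
    let p , hp , e = point (m+n≤o⇒m≤o∸n o o+d≤q) (≤-<-trans (m∸n≤m (toℕ q) d) (toℕ<n q))
    in  p , hp , direct (trans (cong (_+ d) e) (m∸n+n≡m (m+n≤o⇒n≤o o o+d≤q)))
  ... | no o+d≰q =
    let p , hp , e = point (m+n≤o⇒m≤o∸n o o+d≤q+n) (∸-<ˡ q+n<o+n+d d≤q+n)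
    in  p , hp , wrapped (trans (cong (_+ d) e) (m∸n+n≡m d≤q+n))
    where
    o+d≤q+n : o + d ≤ toℕ q + n
    o+d≤q+n = <⇒≤ (<-≤-trans (+-monoʳ-< o d<n) (+-monoˡ-≤ n o≤q))
    d≤q+n : d ≤ toℕ q + n
    d≤q+n = m+n≤o⇒n≤o o o+d≤q+n
    q+n<o+n+d : toℕ q + n < o + n + d
    q+n<o+n+d = subst (toℕ q + n <_) (xy∙z≈xz∙y o d n) (+-monoˡ-< n (≰⇒> o+d≰q))

  ⟶-distance-exists : ∀ {p q} → High p → High q → p ≢ q → ∃ λ d → 0 < d × d < n × p ⟶[ d ] q
  ⟶-distance-exists {p} {q} hp hq p≢q with toℕ p <? toℕ q
  ... | yes p<q = toℕ q ∸ toℕ p , m<n⇒0<n∸m p<q ,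
                  ∸-<ˡ (subst (toℕ q <_) (+-comm (toℕ p) n) (high-span hp)) (<⇒≤ p<q) ,
                  direct (m+[n∸m]≡n (<⇒≤ p<q))
  ... | no p≮q  = toℕ q + n ∸ toℕ p , m<n⇒0<n∸m p<q+n ,
                  ∸-<ˡ (subst (_< n + toℕ p) (+-comm n (toℕ q)) (+-monoʳ-< n q<p)) (<⇒≤ p<q+n) ,
                  wrapped (m+[n∸m]≡n (<⇒≤ p<q+n))
    where
    q<p : toℕ q < toℕ p
    q<p = ≤∧≢⇒< (≮⇒≥ p≮q) (≢-sym (p≢q ∘ toℕ-injective))
    p<q+n : toℕ p < toℕ q + n
    p<q+n = high-span hq

_≟ᵗ_ : ∀ {m} → DecidableEquality (Triple m)
⟨ a , b , c ⟩ ≟ᵗ ⟨ a′ , b′ , c′ ⟩ =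
  map′ (λ { (refl , refl , refl) → refl }) (λ { refl → refl , refl , refl })
       (a Fin.≟ a′ ×-dec b Fin.≟ b′ ×-dec c Fin.≟ c′)

mapTriple : ∀ {m m′} → (Fin m → Fin m′) → Triple m → Triple m′
mapTriple f ⟨ a , b , c ⟩ = ⟨ f a , f b , f c ⟩

Distinct-map : ∀ {m m′} {f : Fin m → Fin m′} → Injective _≡_ _≡_ f →
               ∀ {s} → Distinct s → Distinct (mapTriple f s)
Distinct-map f-inj (a≢b , a≢c , b≢c) = a≢b ∘ f-inj , a≢c ∘ f-inj , b≢c ∘ f-inj

HasEdge-map⁺ : ∀ {m m′} (f : Fin m → Fin m′) {s a b} → HasEdge s a b →
               HasEdge (mapTriple f s) (f a) (f b)
HasEdge-map⁺ f (inj₁ (refl , refl))        = inj₁ (refl , refl)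
HasEdge-map⁺ f (inj₂ (inj₁ (refl , refl))) = inj₂ (inj₁ (refl , refl))
HasEdge-map⁺ f (inj₂ (inj₂ (refl , refl))) = inj₂ (inj₂ (refl , refl))

HasEdge-map⁻ : ∀ {m m′} (f : Fin m → Fin m′) {s a b} → HasEdge (mapTriple f s) a b →
               ∃₂ λ a₀ b₀ → f a₀ ≡ a × f b₀ ≡ b × HasEdge s a₀ b₀
HasEdge-map⁻ f {s} (inj₁ (refl , refl))        = fst s , snd s , refl , refl , inj₁ (refl , refl)
HasEdge-map⁻ f {s} (inj₂ (inj₁ (refl , refl))) = fst s , thd s , refl , refl , inj₂ (inj₁ (refl , refl))
HasEdge-map⁻ f {s} (inj₂ (inj₂ (refl , refl))) = snd s , thd s , refl , refl , inj₂ (inj₂ (refl , refl))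

HasEdge-endpoints : ∀ {m} (Q : Fin m → Set) {t a b} → Q (fst t) → Q (snd t) → Q (thd t) →
                    HasEdge t a b → Q a × Q b
HasEdge-endpoints Q qx qy qz (inj₁ (refl , refl))        = qx , qy
HasEdge-endpoints Q qx qy qz (inj₂ (inj₁ (refl , refl))) = qx , qz
HasEdge-endpoints Q qx qy qz (inj₂ (inj₂ (refl , refl))) = qy , qz

private
  triple : ∀ {m} → Fin m → Fin m × Fin m → Triple m
  triple a (b , c) = ⟨ a , b , c ⟩

allTriples : ∀ m → List (Triple m)
allTriples m = cartesianProductWith triple (allFin m) (cartesianProduct (allFin m) (allFin m))

allTriples-unique : ∀ m → Unique (allTriples m)
allTriples-unique m =
  Unique.cartesianProductWith⁺ triple (λ { refl → refl , refl }) (Unique.allFin⁺ m)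
    (Unique.cartesianProduct⁺ (Unique.allFin⁺ m) (Unique.allFin⁺ m))

∈-allTriples : ∀ {m} (t : Triple m) → t ∈ allTriples m
∈-allTriples t =
  ∈-cartesianProductWith⁺ triple (∈-allFin (fst t))
    (∈-cartesianProduct⁺ (∈-allFin (snd t)) (∈-allFin (thd t)))

module _ {m : ℕ} {P : Triple m → Set} (P? : Decidable P) where

  triplesWhere : List (Triple m)
  triplesWhere = filter P? (allTriples m)

  ∈-triplesWhere⁺ : ∀ {t} → P t → t ∈ triplesWhere
  ∈-triplesWhere⁺ {t} = ∈-filter⁺ P? (∈-allTriples t)

  ∈-triplesWhere⁻ : ∀ {t} → t ∈ triplesWhere → P t
  ∈-triplesWhere⁻ t∈ = proj₂ (∈-filter⁻ P? {xs = allTriples m} t∈)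

  triplesWhere-isDTS : (∀ {t} → P t → Distinct t) →
                       (∀ a b → a ≢ b → ∃ λ t → P t × HasEdge t a b) →
                       (∀ {a b t u} → P t → P u → HasEdge t a b → HasEdge u a b → t ≡ u) →
                       IsDTS m triplesWhere
  triplesWhere-isDTS distinct covered once = record
    { unique   = Unique.filter⁺ P? (allTriples-unique m)
    ; distinct = distinct ∘ ∈-triplesWhere⁻
    ; covered  = λ a b a≢b → let t , pt , h = covered a b a≢b in t , ∈-triplesWhere⁺ pt , h
    ; once     = λ _ _ t∈ u∈ → once (∈-triplesWhere⁻ t∈) (∈-triplesWhere⁻ u∈)
    }

-- IsGoodSequencing B σ unfolds to ∀ {t} → t ∈ B → ¬ InOrder σ t.
InOrder : ∀ {m} → Fin m ↔ Fin m → Triple m → Set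
InOrder {m} σ t = Σ (Fin m) λ i → Σ (Fin m) λ j → Σ (Fin m) λ k →
  toℕ i < toℕ j × toℕ j < toℕ k × to σ i ≡ fst t × to σ j ≡ snd t × to σ k ≡ thd t

toℕ-↑ˡ< : ∀ {m} (a : Fin m) n → toℕ (a ↑ˡ n) < m
toℕ-↑ˡ< a n = subst (_< _) (sym (toℕ-↑ˡ a n)) (toℕ<n a)

<⇒↑ˡ : ∀ {m} n {p : Fin (m + n)} → toℕ p < m → ∃ λ a → a ↑ˡ n ≡ p
<⇒↑ˡ {m} n {p} p<m = fromℕ< p<m , splitAt⁻¹-↑ˡ (splitAt-< m p p<m)

module _ {m : ℕ} (n : ℕ) (σ : Fin m ↔ Fin m) where

  extendˡ : Fin (m + n) ↔ Fin (m + n)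
  extendˡ = ↔-sym +↔⊎ ↔-∘ ((σ ⊎-↔ ↔-id (Fin n)) ↔-∘ +↔⊎)

  private
    m≤toℕ-↑ʳ : ∀ (i : Fin n) → m ≤ toℕ (m ↑ʳ i)
    m≤toℕ-↑ʳ i = subst (m ≤_) (sym (toℕ-↑ʳ m i)) (m≤m+n m (toℕ i))

  extendˡ-to-↑ˡ : ∀ {p} {c : Fin m} → to extendˡ p ≡ c ↑ˡ n → ∃ λ a → a ↑ˡ n ≡ p × to σ a ≡ c
  extendˡ-to-↑ˡ {p} e with splitAt m p in eq
  ... | inj₁ a = a , splitAt⁻¹-↑ˡ eq , ↑ˡ-injective n _ _ e
  ... | inj₂ i = ⊥-elim (<⇒≱ (subst (λ q → toℕ q < m) (sym e) (toℕ-↑ˡ< _ n)) (m≤toℕ-↑ʳ i))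

  extendˡ-to-low : ∀ {p q : Fin (m + n)} → to extendˡ p ≡ q → toℕ q < m → toℕ p < m
  extendˡ-to-low {p} e q<m with splitAt m p in eq
  ... | inj₁ a = subst (λ r → toℕ r < m) (splitAt⁻¹-↑ˡ eq) (toℕ-↑ˡ< a n)
  ... | inj₂ i = ⊥-elim (<⇒≱ q<m (subst (λ r → m ≤ toℕ r) e (m≤toℕ-↑ʳ i)))

  extendˡ-to-high : ∀ {p q : Fin (m + n)} → to extendˡ p ≡ q → m ≤ toℕ q → p ≡ q
  extendˡ-to-high {p} e m≤q with splitAt m p in eq
  ... | inj₁ a = ⊥-elim (<⇒≱ (subst (λ r → toℕ r < m) e (toℕ-↑ˡ< _ n)) m≤q)
  ... | inj₂ i = trans (sym (splitAt⁻¹-↑ʳ eq)) e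

module Doubling (v : ℕ) {B : List (Triple v)} (isDTS : IsDTS v B)
                (σ : Fin v ↔ Fin v) (good : IsGoodSequencing B σ) where

  n N : ℕ
  n = v + 4
  N = v + n

  open CyclicShift v n

  Low : Fin N → Set
  Low p = toℕ p < v

  low? : Decidable Low
  low? p = toℕ p <? v

  low-high : ∀ {p} → Low p → High p → ⊥
  low-high = <⇒≱

  v<n : v < n
  v<n = m<m+n v z<s

  short<n : ∀ {k} → k < v → suc k < n
  short<n k<v = ≤-<-trans k<v v<n

  1<4 : 1 < 4
  1<4 = s<s z<s
  2<4 : 2 < 4
  2<4 = s<s (s<s z<s)
  3<4 : 3 < 4
  3<4 = s<s (s<s (s<s z<s))

  long<n : ∀ {k} → k < 4 → v + k < n
  long<n = +-monoʳ-< v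

  base-block-sum : v + 3 + (v + 2) ≡ v + 1 + n
  base-block-sum = identity v
    where
    identity : ∀ v → v + 3 + (v + 2) ≡ v + 1 + (v + 4)
    identity = solve-∀

  embed : Triple v → Triple N
  embed = mapTriple (_↑ˡ n)

  Embedded : Triple N → Set
  Embedded t = t ∈ map embed B

  Cyclic : Triple N → Set
  Cyclic ⟨ x , y , z ⟩ = High x × High y × High z × x ⟶[ v + 3 ] y × y ⟶[ v + 2 ] z

  Mixed : Triple N → Set
  Mixed ⟨ x , a , z ⟩ = High x × Low a × High z × x ⟶[ suc (toℕ a) ] z

  IsNewTriple : Triple N → Set
  IsNewTriple t = Embedded t ⊎ Cyclic t ⊎ Mixed t

  isNewTriple? : Decidable IsNewTriple
  isNewTriple? t = t ∈? map embed B ⊎-dec cyclic? t ⊎-dec mixed? t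
    where
    open import Data.List.Membership.DecPropositional _≟ᵗ_ using (_∈?_)
    cyclic? : Decidable Cyclic
    cyclic? ⟨ x , y , z ⟩ =
      high? x ×-dec high? y ×-dec high? z ×-dec x ⟶?[ v + 3 ] y ×-dec y ⟶?[ v + 2 ] z
    mixed? : Decidable Mixed
    mixed? ⟨ x , a , z ⟩ = high? x ×-dec low? a ×-dec high? z ×-dec x ⟶?[ suc (toℕ a) ] z

  cyclic-outer : ∀ {t} → Cyclic t → fst t ⟶[ v + 1 ] thd t
  cyclic-outer (hx , _ , _ , s₁₂ , s₂₃) = ⟶-trans base-block-sum hx s₁₂ s₂₃

  long-distance-unique : ∀ {i j p q} → i < 4 → j < 4 → p ⟶[ v + i ] q → p ⟶[ v + j ] q → i ≡ j
  long-distance-unique {i} {j} i<4 j<4 s s′ =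
    +-cancelˡ-≡ v i j (⟶-distance-unique (long<n i<4) (long<n j<4) s s′)

  long⇒≢ : ∀ {k p q} → 0 < k → k < 4 → p ⟶[ v + k ] q → p ≢ q
  long⇒≢ {k} 0<k k<4 = ⟶-positive⇒≢ (<-≤-trans 0<k (m≤n+m k v)) (long<n k<4)

  embedded-distinct : ∀ {t} → Embedded t → Distinct t
  embedded-distinct t∈ with ∈-map⁻ embed t∈
  ... | s , s∈B , refl = Distinct-map (↑ˡ-injective n _ _) (IsDTS.distinct isDTS s∈B)

  cyclic-distinct : ∀ {t} → Cyclic t → Distinct t
  cyclic-distinct c@(_ , _ , _ , s₁₂ , s₂₃) =
    long⇒≢ z<s 3<4 s₁₂ , long⇒≢ z<s 1<4 (cyclic-outer c) , long⇒≢ z<s 2<4 s₂₃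

  mixed-distinct : ∀ {t} → Mixed t → Distinct t
  mixed-distinct (hx , la , hz , s) =
    (λ { refl → low-high la hx }) , ⟶-positive⇒≢ z<s (short<n la) s , (λ { refl → low-high la hz })

  newTriple-distinct : ∀ {t} → IsNewTriple t → Distinct t
  newTriple-distinct (inj₁ e)        = embedded-distinct e
  newTriple-distinct (inj₂ (inj₁ c)) = cyclic-distinct c
  newTriple-distinct (inj₂ (inj₂ m)) = mixed-distinct m

  embedded-once : ∀ {t u a b} → Embedded t → Embedded u → HasEdge t a b → HasEdge u a b → t ≡ u
  embedded-once t∈ u∈ ht hu with ∈-map⁻ embed t∈ | ∈-map⁻ embed u∈
  ... | s , s∈B , refl | s′ , s′∈B , refl with HasEdge-map⁻ (_↑ˡ n) ht | HasEdge-map⁻ (_↑ˡ n) hu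
  ... | a₀ , b₀ , refl , refl , h | a₁ , b₁ , e₁ , e₂ , h′
    with ↑ˡ-injective n a₁ a₀ e₁ | ↑ˡ-injective n b₁ b₀ e₂
  ... | refl | refl = cong embed (IsDTS.once isDTS a₀ b₀ s∈B s′∈B h h′)

  cyclic-once : ∀ {t u a b} → Cyclic t → Cyclic u → HasEdge t a b → HasEdge u a b → t ≡ u
  cyclic-once {⟨ x , y , _ ⟩} (_ , _ , hz , _ , s₂₃) (_ , _ , hz′ , _ , s₂₃′)
    (inj₁ (refl , refl)) (inj₁ (refl , refl)) =
    cong (λ z → ⟨ x , y , z ⟩) (⟶-target-unique hz hz′ s₂₃ s₂₃′)
  cyclic-once (_ , _ , _ , s₁₂ , _) c′ (inj₁ (refl , refl)) (inj₂ (inj₁ (refl , refl))) =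
    contradiction (long-distance-unique 3<4 1<4 s₁₂ (cyclic-outer c′)) λ ()
  cyclic-once (_ , _ , _ , s₁₂ , _) (_ , _ , _ , _ , s₂₃′)
    (inj₁ (refl , refl)) (inj₂ (inj₂ (refl , refl))) =
    contradiction (long-distance-unique 3<4 2<4 s₁₂ s₂₃′) λ ()
  cyclic-once c (_ , _ , _ , s₁₂′ , _) (inj₂ (inj₁ (refl , refl))) (inj₁ (refl , refl)) =
    contradiction (long-distance-unique 1<4 3<4 (cyclic-outer c) s₁₂′) λ ()
  cyclic-once {⟨ x , _ , z ⟩} (_ , hy , _ , s₁₂ , _) (_ , hy′ , _ , s₁₂′ , _)
    (inj₂ (inj₁ (refl , refl))) (inj₂ (inj₁ (refl , refl))) =
    cong (λ y → ⟨ x , y , z ⟩) (⟶-target-unique hy hy′ s₁₂ s₁₂′)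
  cyclic-once c (_ , _ , _ , _ , s₂₃′) (inj₂ (inj₁ (refl , refl))) (inj₂ (inj₂ (refl , refl))) =
    contradiction (long-distance-unique 1<4 2<4 (cyclic-outer c) s₂₃′) λ ()
  cyclic-once (_ , _ , _ , _ , s₂₃) (_ , _ , _ , s₁₂′ , _)
    (inj₂ (inj₂ (refl , refl))) (inj₁ (refl , refl)) =
    contradiction (long-distance-unique 2<4 3<4 s₂₃ s₁₂′) λ ()
  cyclic-once (_ , _ , _ , _ , s₂₃) c′ (inj₂ (inj₂ (refl , refl))) (inj₂ (inj₁ (refl , refl))) =
    contradiction (long-distance-unique 2<4 1<4 s₂₃ (cyclic-outer c′)) λ ()
  cyclic-once {⟨ _ , y , z ⟩} (hx , _ , _ , s₁₂ , _) (hx′ , _ , _ , s₁₂′ , _)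
    (inj₂ (inj₂ (refl , refl))) (inj₂ (inj₂ (refl , refl))) =
    cong (λ x → ⟨ x , y , z ⟩) (⟶-source-unique hx hx′ s₁₂ s₁₂′)

  mixed-once : ∀ {t u a b} → Mixed t → Mixed u → HasEdge t a b → HasEdge u a b → t ≡ u
  mixed-once {⟨ x , a , _ ⟩} (_ , _ , hz , s) (_ , _ , hz′ , s′)
    (inj₁ (refl , refl)) (inj₁ (refl , refl)) =
    cong (λ z → ⟨ x , a , z ⟩) (⟶-target-unique hz hz′ s s′)
  mixed-once (_ , la , _ , _) (_ , _ , hz′ , _) (inj₁ (refl , refl)) (inj₂ (inj₁ (refl , refl))) =
    ⊥-elim (low-high la hz′)
  mixed-once (hx , _ , _ , _) (_ , la′ , _ , _) (inj₁ (refl , refl)) (inj₂ (inj₂ (refl , refl))) =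
    ⊥-elim (low-high la′ hx)
  mixed-once (_ , _ , hz , _) (_ , la′ , _ , _) (inj₂ (inj₁ (refl , refl))) (inj₁ (refl , refl)) =
    ⊥-elim (low-high la′ hz)
  mixed-once {⟨ x , _ , z ⟩} (_ , la , _ , s) (_ , la′ , _ , s′)
    (inj₂ (inj₁ (refl , refl))) (inj₂ (inj₁ (refl , refl))) =
    cong (λ a → ⟨ x , a , z ⟩)
      (toℕ-injective (suc-injective (⟶-distance-unique (short<n la) (short<n la′) s s′)))
  mixed-once (hx , _ , _ , _) (_ , la′ , _ , _) (inj₂ (inj₁ (refl , refl))) (inj₂ (inj₂ (refl , refl))) =
    ⊥-elim (low-high la′ hx)
  mixed-once (_ , la , _ , _) (hx′ , _ , _ , _) (inj₂ (inj₂ (refl , refl))) (inj₁ (refl , refl)) =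
    ⊥-elim (low-high la hx′)
  mixed-once (_ , la , _ , _) (hx′ , _ , _ , _) (inj₂ (inj₂ (refl , refl))) (inj₂ (inj₁ (refl , refl))) =
    ⊥-elim (low-high la hx′)
  mixed-once {⟨ _ , a , z ⟩} (hx , _ , _ , s) (hx′ , _ , _ , s′)
    (inj₂ (inj₂ (refl , refl))) (inj₂ (inj₂ (refl , refl))) =
    cong (λ x → ⟨ x , a , z ⟩) (⟶-source-unique hx hx′ s s′)

  embedded-edge : ∀ {t a b} → Embedded t → HasEdge t a b → Low a × Low b
  embedded-edge t∈ h with ∈-map⁻ embed t∈
  ... | s , _ , refl =
    HasEdge-endpoints Low (toℕ-↑ˡ< (fst s) n) (toℕ-↑ˡ< (snd s) n) (toℕ-↑ˡ< (thd s) n) h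

  cyclic-edge : ∀ {t a b} → Cyclic t → HasEdge t a b →
                High a × High b × ∃ λ k → 0 < k × k < 4 × a ⟶[ v + k ] b
  cyclic-edge (hx , hy , _ , s₁₂ , _) (inj₁ (refl , refl))        = hx , hy , 3 , z<s , 3<4 , s₁₂
  cyclic-edge c@(hx , _ , hz , _ , _) (inj₂ (inj₁ (refl , refl))) = hx , hz , 1 , z<s , 1<4 , cyclic-outer c
  cyclic-edge (_ , hy , hz , _ , s₂₃) (inj₂ (inj₂ (refl , refl))) = hy , hz , 2 , z<s , 2<4 , s₂₃

  mixed-edge : ∀ {t a b} → Mixed t → HasEdge t a b →
               (High a × Low b) ⊎ (Low a × High b) ⊎ (High a × ∃ λ c → Low c × a ⟶[ suc (toℕ c) ] b)
  mixed-edge (hx , la , _ , _) (inj₁ (refl , refl))             = inj₁ (hx , la)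
  mixed-edge {t} (hx , la , _ , s) (inj₂ (inj₁ (refl , refl)))  = inj₂ (inj₂ (hx , snd t , la , s))
  mixed-edge (_ , la , hz , _) (inj₂ (inj₂ (refl , refl)))      = inj₂ (inj₁ (la , hz))

  embedded-cyclic-disjoint : ∀ {t u a b} → Embedded t → Cyclic u → HasEdge t a b → HasEdge u a b → ⊥
  embedded-cyclic-disjoint e c ht hu = low-high (proj₁ (embedded-edge e ht)) (proj₁ (cyclic-edge c hu))

  embedded-mixed-disjoint : ∀ {t u a b} → Embedded t → Mixed u → HasEdge t a b → HasEdge u a b → ⊥
  embedded-mixed-disjoint e m ht hu with embedded-edge e ht | mixed-edge m hu
  ... | la , _  | inj₁ (ha , _)        = low-high la ha
  ... | _  , lb | inj₂ (inj₁ (_ , hb)) = low-high lb hb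
  ... | la , _  | inj₂ (inj₂ (ha , _)) = low-high la ha

  cyclic-mixed-disjoint : ∀ {t u a b} → Cyclic t → Mixed u → HasEdge t a b → HasEdge u a b → ⊥
  cyclic-mixed-disjoint c m ht hu with cyclic-edge c ht | mixed-edge m hu
  ... | _  , hb , _ | inj₁ (_ , lb)        = low-high lb hb
  ... | ha , _  , _ | inj₂ (inj₁ (la , _)) = low-high la ha
  ... | _ , _ , k , 0<k , k<4 , s | inj₂ (inj₂ (_ , c , lc , s′)) =
    <-irrefl (⟶-distance-unique (short<n lc) (long<n k<4) s′ s) (≤-<-trans lc (m<m+n v 0<k))

  newTriple-once : ∀ {a b t u} → IsNewTriple t → IsNewTriple u → HasEdge t a b → HasEdge u a b → t ≡ u
  newTriple-once (inj₁ e)        (inj₁ e′)        ht hu = embedded-once e e′ ht hu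
  newTriple-once (inj₁ e)        (inj₂ (inj₁ c))  ht hu = ⊥-elim (embedded-cyclic-disjoint e c ht hu)
  newTriple-once (inj₁ e)        (inj₂ (inj₂ m))  ht hu = ⊥-elim (embedded-mixed-disjoint e m ht hu)
  newTriple-once (inj₂ (inj₁ c)) (inj₁ e)         ht hu = ⊥-elim (embedded-cyclic-disjoint e c hu ht)
  newTriple-once (inj₂ (inj₁ c)) (inj₂ (inj₁ c′)) ht hu = cyclic-once c c′ ht hu
  newTriple-once (inj₂ (inj₁ c)) (inj₂ (inj₂ m))  ht hu = ⊥-elim (cyclic-mixed-disjoint c m ht hu)
  newTriple-once (inj₂ (inj₂ m)) (inj₁ e)         ht hu = ⊥-elim (embedded-mixed-disjoint e m hu ht)
  newTriple-once (inj₂ (inj₂ m)) (inj₂ (inj₁ c))  ht hu = ⊥-elim (cyclic-mixed-disjoint c m hu ht)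
  newTriple-once (inj₂ (inj₂ m)) (inj₂ (inj₂ m′)) ht hu = mixed-once m m′ ht hu

  low-covers : ∀ {a b} → Low a → Low b → a ≢ b → ∃ λ t → Embedded t × HasEdge t a b
  low-covers la lb a≢b with <⇒↑ˡ n la | <⇒↑ˡ n lb
  ... | a₀ , refl | b₀ , refl with IsDTS.covered isDTS a₀ b₀ (a≢b ∘ cong (_↑ˡ n))
  ... | s , s∈B , h = embed s , ∈-map⁺ embed s∈B , HasEdge-map⁺ (_↑ˡ n) h

  short-covers : ∀ {a b k} → High a → High b → k < v → a ⟶[ suc k ] b →
                 ∃ λ t → Mixed t × HasEdge t a b
  short-covers {a} {b} ha hb k<v s with numbered (<-≤-trans k<v (m≤m+n v n))
    where
    numbered : ∀ {k} → k < N → ∃ λ (c : Fin N) → toℕ c ≡ k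
    numbered k<N = fromℕ< k<N , toℕ-fromℕ< k<N
  ... | c , refl = ⟨ a , c , b ⟩ , (ha , k<v , hb , s) , inj₂ (inj₁ (refl , refl))

  long-covers : ∀ {a b} k → High a → High b → 0 < k → k < 4 → a ⟶[ v + k ] b →
                ∃ λ t → Cyclic t × HasEdge t a b
  long-covers {a} {b} 1 ha hb _ _ s₁₃ with ⟶-target-exists ha (long<n 3<4)
  ... | q , hq , s₁₂ with ⟶-target-exists hq (long<n 2<4)
  ...   | r , hr , s₂₃
    with ⟶-target-unique hr hb (cyclic-outer {⟨ a , q , r ⟩} (ha , hq , hr , s₁₂ , s₂₃)) s₁₃
  ...     | refl = ⟨ a , q , b ⟩ , (ha , hq , hb , s₁₂ , s₂₃) , inj₂ (inj₁ (refl , refl))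
  long-covers {a} {b} 2 ha hb _ _ s₂₃ with ⟶-source-exists ha (long<n 3<4)
  ... | p , hp , s₁₂ = ⟨ p , a , b ⟩ , (hp , ha , hb , s₁₂ , s₂₃) , inj₂ (inj₂ (refl , refl))
  long-covers {a} {b} 3 ha hb _ _ s₁₂ with ⟶-target-exists hb (long<n 2<4)
  ... | r , hr , s₂₃ = ⟨ a , b , r ⟩ , (ha , hb , hr , s₁₂ , s₂₃) , inj₁ (refl , refl)
  long-covers 0 _ _ () _ _
  long-covers (suc (suc (suc (suc _)))) _ _ _ (s<s (s<s (s<s (s<s ())))) _

  high-covers : ∀ {a b} → High a → High b → a ≢ b → ∃ λ t → IsNewTriple t × HasEdge t a b
  high-covers ha hb a≢b with ⟶-distance-exists ha hb a≢b
  ... | d , 0<d , d<n , s with v <? d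
  ...   | yes v<d with m≤n⇒∃[o]m+o≡n (<⇒≤ v<d)
  ...     | j , refl =
    let t , c , h = long-covers j ha hb 0<j (+-cancelˡ-< v j 4 d<n) s in t , inj₂ (inj₁ c) , h
    where
    0<j : 0 < j
    0<j = +-cancelˡ-< v 0 j (subst (_< v + j) (sym (+-identityʳ v)) v<d)
  high-covers ha hb a≢b | suc k , _ , _ , s | no v≮d =
    let t , m , h = short-covers ha hb (≮⇒≥ v≮d) s in t , inj₂ (inj₂ m) , h
  high-covers _ _ _ | zero , () , _ | no _

  newTriple-covers : ∀ a b → a ≢ b → ∃ λ t → IsNewTriple t × HasEdge t a b
  newTriple-covers a b a≢b with low? a | low? b
  ... | yes la | yes lb = let t , e , h = low-covers la lb a≢b in t , inj₁ e , h
  ... | no la≮ | yes lb =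
    let q , hq , s = ⟶-target-exists (≮⇒≥ la≮) (short<n lb)
    in  ⟨ a , b , q ⟩ , inj₂ (inj₂ (≮⇒≥ la≮ , lb , hq , s)) , inj₁ (refl , refl)
  ... | yes la | no lb≮ =
    let p , hp , s = ⟶-source-exists (≮⇒≥ lb≮) (short<n la)
    in  ⟨ p , a , b ⟩ , inj₂ (inj₂ (hp , la , ≮⇒≥ lb≮ , s)) , inj₂ (inj₂ (refl , refl))
  ... | no la≮ | no lb≮ = high-covers (≮⇒≥ la≮) (≮⇒≥ lb≮) a≢b

  σ′ : Fin N ↔ Fin N
  σ′ = extendˡ n σ

  embedded-not-inOrder : ∀ {t} → Embedded t → ¬ InOrder σ′ t
  embedded-not-inOrder t∈ (i , j , k , i<j , j<k , ei , ej , ek) with ∈-map⁻ embed t∈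
  ... | s , s∈B , refl with extendˡ-to-↑ˡ n σ ei | extendˡ-to-↑ˡ n σ ej | extendˡ-to-↑ˡ n σ ek
  ... | a , refl , ea | b , refl , eb | c , refl , ec =
    good s∈B (a , b , c , ↑ˡ-cancel-< a b i<j , ↑ˡ-cancel-< b c j<k , ea , eb , ec)
    where
    ↑ˡ-cancel-< : ∀ a b → toℕ (a ↑ˡ n) < toℕ (b ↑ˡ n) → toℕ a < toℕ b
    ↑ˡ-cancel-< a b = subst₂ _<_ (toℕ-↑ˡ a n) (toℕ-↑ˡ b n)

  cyclic-not-inOrder : ∀ {t} → Cyclic t → ¬ InOrder σ′ t
  cyclic-not-inOrder (hx , hy , hz , s₁₂ , s₂₃) (i , j , k , i<j , j<k , ei , ej , ek)
    with extendˡ-to-high n σ ei hx | extendˡ-to-high n σ ej hy | extendˡ-to-high n σ ek hz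
  ... | refl | refl | refl = <⇒≱ (toℕ<n k) (begin
    v + n                       ≤⟨ +-monoˡ-≤ n hx ⟩
    toℕ i + n                   ≤⟨ +-monoʳ-≤ (toℕ i) (m≤n+m n (v + 1)) ⟩
    toℕ i + (v + 1 + n)         ≡⟨ cong (toℕ i +_) base-block-sum ⟨
    toℕ i + (v + 3 + (v + 2))   ≡⟨ +-assoc (toℕ i) (v + 3) (v + 2) ⟨
    toℕ i + (v + 3) + (v + 2)   ≡⟨ cong (_+ (v + 2)) (⟶-ascending (long<n 3<4) i<j s₁₂) ⟩
    toℕ j + (v + 2)             ≡⟨ ⟶-ascending (long<n 2<4) j<k s₂₃ ⟩
    toℕ k                       ∎)
    where open ≤-Reasoning

  mixed-not-inOrder : ∀ {t} → Mixed t → ¬ InOrder σ′ t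
  mixed-not-inOrder (hx , la , _ , _) (i , j , _ , i<j , _ , ei , ej , _) =
    <⇒≱ (<-trans i<j (extendˡ-to-low n σ ej la)) (subst High (sym (extendˡ-to-high n σ ei hx)) hx)

  newTriple-good : IsGoodSequencing (triplesWhere isNewTriple?) σ′
  newTriple-good t∈ with ∈-triplesWhere⁻ isNewTriple? t∈
  ... | inj₁ e        = embedded-not-inOrder e
  ... | inj₂ (inj₁ c) = cyclic-not-inOrder c
  ... | inj₂ (inj₂ m) = mixed-not-inOrder m

  doubled : HasGoodDTS N
  doubled = triplesWhere isNewTriple? ,
            triplesWhere-isDTS isNewTriple? newTriple-distinct newTriple-covers newTriple-once ,
            σ′ , newTriple-good

lemma2p4 : (v : ℕ) → HasGoodDTS v → HasGoodDTS (2 * v + 4)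
lemma2p4 v (_ , isDTS , σ , good) = subst HasGoodDTS (v+[v+4]≡2*v+4 v) (Doubling.doubled v isDTS σ good)
  where
  v+[v+4]≡2*v+4 : ∀ v → v + (v + 4) ≡ 2 * v + 4
  v+[v+4]≡2*v+4 = solve-∀
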